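{- Let $\mathbb{F}$ be a field of characteristic $2$, $\ell\in\mathbb{F}^m$, and let $A$ be a gSDR of some $r\in\mathcal{R}(\ell^2)$. Then there exists a gSDR $B$ of $r$ (of the same size) all of whose non-diagonal entries are constants, i.e. lie in $\mathbb{F}\subseteq\mathcal{R}(\ell^2)$.
   Context: $\ell^2=(\ell_1^2,\dots,\ell_m^2)$, $\mathcal{I}(\ell^2)=\langle x_1^2+\ell_1^2,\dots,x_m^2+\ell_m^2\rangle$, $\mathcal{R}(\ell^2)=\mathbb{F}[x_1,\dots,x_m]/\mathcal{I}(\ell^2)$, into which $\mathbb{F}$ embeds as constants. An element is linear if it is the projection of a polynomial of total degree at most $1$. A gSDR of $r\in\mathcal{R}(\ell^2)$ is a symmetric matrix $A$ with entries in $\mathcal{R}(\ell^2)$ whose diagonal entries are linear and with $\det(A)=r$. -}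

module Defs where

open import Level using (_⊔_)
open import Data.Nat using (ℕ; zero; suc)
open import Data.Fin using (Fin; zero; suc; punchIn)
open import Data.Product using (Σ; ∃; _×_)
open import Relation.Nullary using (¬_)
open import Algebra.Bundles using (CommutativeRing)

IsField : ∀ {c ℓ} → CommutativeRing c ℓ → Set (c ⊔ ℓ)
IsField F = ¬ (0# ≈ 1#) × (∀ x → ¬ (x ≈ 0#) → ∃ λ y → x * y ≈ 1#)
  where open CommutativeRing F

HasChar2 : ∀ {c ℓ} → CommutativeRing c ℓ → Set ℓ
HasChar2 F = 1# + 1# ≈ 0#
  where open CommutativeRing F

-- The ring R(ℓ²) = F[x₁,…,xₘ] / ⟨x₁²+ℓ₁², …, xₘ²+ℓₘ²⟩, presented as
-- polynomial expressions modulo the congruence generated by the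
-- commutative-ring axioms, the embedding of F as constants, and the
-- generators xᵢ² + ℓᵢ² ≈ 0 of the ideal.
module Quot {c ℓ} (F : CommutativeRing c ℓ) (m : ℕ) (l : Fin m → CommutativeRing.Carrier F) where
  open CommutativeRing F using (Carrier; _≈_; _+_; _*_; 0#; 1#)

  infixl 6 _⊕_
  infixl 7 _⊗_
  data Expr : Set c where
    var : Fin m → Expr
    con : Carrier → Expr
    _⊕_ : Expr → Expr → Expr
    _⊗_ : Expr → Expr → Expr
    ⊝_  : Expr → Expr

  infix 4 _~_
  data _~_ : Expr → Expr → Set (c ⊔ ℓ) where
    ~refl  : ∀ {p} → p ~ p
    ~sym   : ∀ {p q} → p ~ q → q ~ p
    ~trans : ∀ {p q s} → p ~ q → q ~ s → p ~ s
    ⊕-cong : ∀ {p p′ q q′} → p ~ p′ → q ~ q′ → p ⊕ q ~ p′ ⊕ q′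
    ⊗-cong : ∀ {p p′ q q′} → p ~ p′ → q ~ q′ → p ⊗ q ~ p′ ⊗ q′
    ⊝-cong : ∀ {p q} → p ~ q → ⊝ p ~ ⊝ q
    ⊕-assoc : ∀ p q s → (p ⊕ q) ⊕ s ~ p ⊕ (q ⊕ s)
    ⊕-comm  : ∀ p q → p ⊕ q ~ q ⊕ p
    ⊕-idˡ   : ∀ p → con 0# ⊕ p ~ p
    ⊝-invˡ  : ∀ p → (⊝ p) ⊕ p ~ con 0#
    ⊗-assoc : ∀ p q s → (p ⊗ q) ⊗ s ~ p ⊗ (q ⊗ s)
    ⊗-comm  : ∀ p q → p ⊗ q ~ q ⊗ p
    ⊗-idˡ   : ∀ p → con 1# ⊗ p ~ p
    ⊗-distribˡ : ∀ p q s → p ⊗ (q ⊕ s) ~ (p ⊗ q) ⊕ (p ⊗ s)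
    con-cong : ∀ {a b} → a ≈ b → con a ~ con b
    con-+ : ∀ a b → con (a + b) ~ con a ⊕ con b
    con-* : ∀ a b → con (a * b) ~ con a ⊗ con b
    rel : ∀ i → var i ⊗ var i ⊕ con (l i * l i) ~ con 0#

  sumE : ∀ {k} → (Fin k → Expr) → Expr
  sumE {zero}  f = con 0#
  sumE {suc k} f = f zero ⊕ sumE (λ i → f (suc i))

  altSum : ∀ {k} → (Fin k → Expr) → Expr
  altSum {zero}  f = con 0#
  altSum {suc k} f = f zero ⊕ ⊝ altSum (λ i → f (suc i))

  Matrix : ℕ → Set c
  Matrix n = Fin n → Fin n → Expr

  det : ∀ {n} → Matrix n → Expr
  det {zero}  A = con 1#
  det {suc n} A = altSum λ j → A zero j ⊗ det (λ r s → A (suc r) (punchIn j s))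

  IsLinear : Expr → Set (c ⊔ ℓ)
  IsLinear e = Σ Carrier λ c₀ → Σ (Fin m → Carrier) λ a →
               e ~ con c₀ ⊕ sumE (λ i → con (a i) ⊗ var i)

  IsConstant : Expr → Set (c ⊔ ℓ)
  IsConstant e = Σ Carrier λ c₀ → e ~ con c₀

  IsSymmetric : ∀ {n} → Matrix n → Set (c ⊔ ℓ)
  IsSymmetric A = ∀ i j → A i j ~ A j i

  IsGSDR : ∀ {n} → Matrix n → Expr → Set (c ⊔ ℓ)
  IsGSDR A r = IsSymmetric A × (∀ i → IsLinear (A i i)) × det A ~ r

-- In characteristic 2 the determinant is the permanent, and the permanent of a
-- symmetric matrix M depends only on its diagonal and on the products
-- M i j * M j i (expanding along the first row and column, the two mixed terms
-- indexed by i ≠ j coincide and cancel). In R(ℓ²) every square is a constant: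
-- squaring is additive, and x_i² = ℓ_i², so e² = e(ℓ)² where e(ℓ) is the value
-- of e at the point x = ℓ. Hence replacing each off-diagonal entry a of A by
-- the constant a(ℓ) preserves symmetry, the diagonal and every product
-- A i j * A j i = A i j ², and therefore the determinant.
module Submission where

open import Defs
open import Level using (_⊔_)
open import Data.Nat using (ℕ; zero; suc)
open import Data.Fin using (Fin; zero; suc; punchIn; _≟_)
open import Data.Product using (Σ; _×_; _,_)
open import Data.Maybe using (nothing)
open import Data.Empty using (⊥-elim)
open import Function using (_∘_)
open import Algebra.Bundles using (CommutativeRing)
open import Algebra.Structures using (IsCommutativeRing)
open import Algebra.Properties.CommutativeSemigroup using (interchange)
open import Relation.Binary.Structures using (IsEquivalence)
open import Relation.Binary.PropositionalEquality using (_≢_)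
import Relation.Binary.PropositionalEquality as ≡
open import Relation.Nullary using (yes; no)

module Permanent {c ℓ} (R : CommutativeRing c ℓ) where
  open CommutativeRing R hiding (zero)
  open import Algebra.Properties.CommutativeSemigroup *-commutativeSemigroup using (x∙yz≈y∙xz)
  open import Algebra.Properties.Semiring.Sum semiring
    using (sum-syntax; sum-cong-≋; ∑-comm; *-distribˡ-sum)
  open import Relation.Binary.Reasoning.Setoid setoid

  Matrix : ℕ → Set c
  Matrix n = Fin n → Fin n → Carrier

  Symmetric : ∀ {n} → Matrix n → Set ℓ
  Symmetric M = ∀ i j → M i j ≈ M j i

  minor : ∀ {n} → Fin (suc n) → Fin (suc n) → Matrix (suc n) → Matrix n
  minor i j M r s = M (punchIn i r) (punchIn j s)

  minor-symmetric : ∀ {n} {M : Matrix (suc n)} i → Symmetric M → Symmetric (minor i i M)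
  minor-symmetric i M-sym r s = M-sym (punchIn i r) (punchIn i s)

  permanent : ∀ {n} → Matrix n → Carrier
  permanent {zero}  M = 1#
  permanent {suc n} M = ∑[ j < suc n ] (M zero j * permanent (minor zero j M))

  permanent-cong : ∀ {n} {M N : Matrix n} → (∀ r s → M r s ≈ N r s) → permanent M ≈ permanent N
  permanent-cong {zero}  M≈N = refl
  permanent-cong {suc n} M≈N = sum-cong-≋ λ j → *-cong (M≈N zero j) (permanent-cong λ r s → M≈N (suc r) (punchIn j s))

  permanent-expand-column₀ : ∀ {n} (M : Matrix (suc n)) → permanent M ≈ ∑[ i < suc n ] (M i zero * permanent (minor i zero M))
  permanent-expand-column₀ {zero}  M = refl
  permanent-expand-column₀ {suc n} M = +-congˡ (begin
    ∑[ j < suc n ] (M zero (suc j) * permanent (minor zero (suc j) M))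
      ≈⟨ sum-cong-≋ (λ j → *-congˡ {M zero (suc j)} (permanent-expand-column₀ (minor zero (suc j) M))) ⟩
    ∑[ j < suc n ] (M zero (suc j) * ∑[ i < suc n ] (M (suc i) zero * permanent (Y i j)))
      ≈⟨ sum-cong-≋ (λ j → *-distribˡ-sum (M zero (suc j)) (λ i → M (suc i) zero * permanent (Y i j))) ⟩
    ∑[ j < suc n ] ∑[ i < suc n ] (M zero (suc j) * (M (suc i) zero * permanent (Y i j)))
      ≈⟨ ∑-comm (λ j i → M zero (suc j) * (M (suc i) zero * permanent (Y i j))) ⟩
    ∑[ i < suc n ] ∑[ j < suc n ] (M zero (suc j) * (M (suc i) zero * permanent (Y i j)))
      ≈⟨ sum-cong-≋ (λ i → sum-cong-≋ λ j → x∙yz≈y∙xz (M zero (suc j)) (M (suc i) zero) (permanent (Y i j))) ⟩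
    ∑[ i < suc n ] ∑[ j < suc n ] (M (suc i) zero * (M zero (suc j) * permanent (Y i j)))
      ≈⟨ sum-cong-≋ (λ i → *-distribˡ-sum (M (suc i) zero) (λ j → M zero (suc j) * permanent (Y i j))) ⟨
    ∑[ i < suc n ] (M (suc i) zero * permanent (minor (suc i) zero M)) ∎)
    where
    Y : Fin (suc n) → Fin (suc n) → Matrix n
    Y i j = minor i zero (minor zero (suc j) M)

  permanent-transpose : ∀ {n} (M : Matrix n) → permanent (λ r s → M s r) ≈ permanent M
  permanent-transpose {zero}  M = refl
  permanent-transpose {suc n} M =
    trans (sum-cong-≋ λ j → *-congˡ {M j zero} (permanent-transpose (minor j zero M))) (sym (permanent-expand-column₀ M))

module Characteristic2 {c ℓ} (R : CommutativeRing c ℓ) (char2 : HasChar2 R) where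
  open CommutativeRing R hiding (zero)
  open import Algebra.Properties.Group +-group using (inverseˡ-unique)
  open import Algebra.Properties.CommutativeSemigroup *-commutativeSemigroup using (x∙yz≈y∙xz)
  open import Algebra.Properties.Semiring.Sum semiring
    using (sum-syntax; sum-cong-≋; ∑-distrib-+; *-distribˡ-sum)
  open import Algebra.Solver.Ring.NaturalCoefficients commutativeSemiring (λ _ _ → nothing)
  open import Relation.Binary.Reasoning.Setoid setoid
  open Permanent R public

  x+x≈0 : ∀ x → x + x ≈ 0#
  x+x≈0 x = begin
    x + x             ≈⟨ +-cong (*-identityˡ x) (*-identityˡ x) ⟨
    1# * x + 1# * x   ≈⟨ distribʳ x 1# 1# ⟨
    (1# + 1#) * x     ≈⟨ *-congʳ char2 ⟩
    0# * x            ≈⟨ zeroˡ x ⟩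
    0#                ∎

  -x≈x : ∀ x → - x ≈ x
  -x≈x x = sym (inverseˡ-unique x x (x+x≈0 x))

  x+y≈0⇒x≈y : ∀ {x y} → x + y ≈ 0# → x ≈ y
  x+y≈0⇒x≈y {x} {y} x+y≈0 = trans (inverseˡ-unique x y x+y≈0) (-x≈x y)

  square-+ : ∀ x y → (x + y) * (x + y) ≈ x * x + y * y
  square-+ x y = begin
    (x + y) * (x + y)               ≈⟨ solve 2 (λ x y → (x :+ y) :* (x :+ y) := (x :* x :+ y :* y) :+ (x :* y :+ x :* y)) refl x y ⟩
    (x * x + y * y) + (x * y + x * y) ≈⟨ +-congˡ (x+x≈0 (x * y)) ⟩
    (x * x + y * y) + 0#            ≈⟨ +-identityʳ _ ⟩
    x * x + y * y                   ∎

  ∑∑-symmetric≈∑-diagonal : ∀ {n} (X : Fin n → Fin n → Carrier) → (∀ i j → X i j ≈ X j i) →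
                             ∑[ i < n ] ∑[ j < n ] X i j ≈ ∑[ i < n ] X i i
  ∑∑-symmetric≈∑-diagonal {zero}  X X-sym = refl
  ∑∑-symmetric≈∑-diagonal {suc n} X X-sym = begin
    (X₀₀ + ∑[ j < n ] X zero (suc j)) + ∑[ i < n ] (X (suc i) zero + ∑[ j < n ] X (suc i) (suc j))
      ≈⟨ +-congˡ (∑-distrib-+ (λ i → X (suc i) zero) _) ⟩
    (X₀₀ + row) + (∑[ i < n ] X (suc i) zero + ∑[ i < n ] ∑[ j < n ] X (suc i) (suc j))
      ≈⟨ +-congˡ (+-cong (sum-cong-≋ (λ i → X-sym (suc i) zero))
                         (∑∑-symmetric≈∑-diagonal (λ i j → X (suc i) (suc j)) (λ i j → X-sym (suc i) (suc j)))) ⟩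
    (X₀₀ + row) + (row + rest)
      ≈⟨ solve 3 (λ x a c → (x :+ a) :+ (a :+ c) := x :+ (a :+ a) :+ c) refl X₀₀ row rest ⟩
    X₀₀ + (row + row) + rest
      ≈⟨ +-congʳ (trans (+-congˡ (x+x≈0 row)) (+-identityʳ X₀₀)) ⟩
    X₀₀ + rest ∎
    where
    X₀₀  = X zero zero
    row  = ∑[ j < n ] X zero (suc j)
    rest = ∑[ i < n ] X (suc i) (suc i)

  permanent-expand-bordered : ∀ {n} (M : Matrix (suc (suc n))) → Symmetric M →
    permanent M ≈ M zero zero * permanent (minor zero zero M)
                  + ∑[ i < suc n ] ((M zero (suc i) * M (suc i) zero) * permanent (minor i i (minor zero zero M)))
  permanent-expand-bordered {n} M M-sym = +-congˡ (begin
    ∑[ j < suc n ] (M zero (suc j) * permanent (minor zero (suc j) M))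
      ≈⟨ sum-cong-≋ (λ j → *-congˡ {M zero (suc j)} (permanent-expand-column₀ (minor zero (suc j) M))) ⟩
    ∑[ j < suc n ] (M zero (suc j) * ∑[ i < suc n ] (M (suc i) zero * permanent (minor i j N)))
      ≈⟨ sum-cong-≋ (λ j → *-distribˡ-sum (M zero (suc j)) (λ i → M (suc i) zero * permanent (minor i j N))) ⟩
    ∑[ j < suc n ] ∑[ i < suc n ] X j i
      ≈⟨ ∑∑-symmetric≈∑-diagonal X X-sym ⟩
    ∑[ i < suc n ] X i i
      ≈⟨ sum-cong-≋ (λ i → *-assoc (M zero (suc i)) (M (suc i) zero) (permanent (minor i i N))) ⟨
    ∑[ i < suc n ] ((M zero (suc i) * M (suc i) zero) * permanent (minor i i N)) ∎)
    where
    N = minor zero zero M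
    X : Fin (suc n) → Fin (suc n) → Carrier
    X j i = M zero (suc j) * (M (suc i) zero * permanent (minor i j N))
    X-sym : ∀ j i → X j i ≈ X i j
    X-sym j i = begin
      M zero (suc j) * (M (suc i) zero * permanent (minor i j N))
        ≈⟨ *-cong (M-sym zero (suc j)) (*-cong (M-sym (suc i) zero) transposed-minor) ⟩
      M (suc j) zero * (M zero (suc i) * permanent (minor j i N))
        ≈⟨ x∙yz≈y∙xz (M (suc j) zero) _ _ ⟩
      M zero (suc i) * (M (suc j) zero * permanent (minor j i N)) ∎
      where
      transposed-minor : permanent (minor i j N) ≈ permanent (minor j i N)
      transposed-minor = trans (sym (permanent-transpose (minor i j N)))
                               (permanent-cong λ r s → M-sym (suc (punchIn i s)) (suc (punchIn j r)))

  symmetric-permanent-cong : ∀ {n} {M N : Matrix n} → Symmetric M → Symmetric N →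
                             (∀ i → M i i ≈ N i i) → (∀ i j → M i j * M j i ≈ N i j * N j i) →
                             permanent M ≈ permanent N
  symmetric-permanent-cong {zero}        M-sym N-sym diag prod = refl
  symmetric-permanent-cong {suc zero}    M-sym N-sym diag prod = +-congʳ (*-congʳ (diag zero))
  symmetric-permanent-cong {suc (suc n)} {M} {N} M-sym N-sym diag prod = begin
    permanent M ≈⟨ permanent-expand-bordered M M-sym ⟩
    M zero zero * permanent (minor zero zero M)
      + ∑[ i < suc n ] ((M zero (suc i) * M (suc i) zero) * permanent (minor i i (minor zero zero M)))
      ≈⟨ +-cong (*-cong (diag zero) (symmetric-permanent-cong (minor-symmetric zero M-sym) (minor-symmetric zero N-sym)
                                                               (diag ∘ suc) (λ i j → prod (suc i) (suc j))))
                (sum-cong-≋ λ i → *-cong (prod zero (suc i))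
                  (symmetric-permanent-cong (minor-symmetric i (minor-symmetric zero M-sym))
                                            (minor-symmetric i (minor-symmetric zero N-sym))
                                            (λ _ → diag _) (λ _ _ → prod _ _))) ⟩
    N zero zero * permanent (minor zero zero N)
      + ∑[ i < suc n ] ((N zero (suc i) * N (suc i) zero) * permanent (minor i i (minor zero zero N)))
      ≈⟨ permanent-expand-bordered N N-sym ⟨
    permanent N ∎

module QuotientRing {c ℓ} (F : CommutativeRing c ℓ) (char2 : HasChar2 F)
                    (m : ℕ) (l : Fin m → CommutativeRing.Carrier F) where
  open CommutativeRing F hiding (zero; isCommutativeRing)
  open Quot F m l

  ⊕-identityʳ : ∀ p → p ⊕ con 0# ~ p
  ⊕-identityʳ p = ~trans (⊕-comm p (con 0#)) (⊕-idˡ p)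

  ⊗-identityʳ : ∀ p → p ⊗ con 1# ~ p
  ⊗-identityʳ p = ~trans (⊗-comm p (con 1#)) (⊗-idˡ p)

  ⊗-distribʳ : ∀ p q s → (q ⊕ s) ⊗ p ~ q ⊗ p ⊕ s ⊗ p
  ⊗-distribʳ p q s =
    ~trans (⊗-comm (q ⊕ s) p) (~trans (⊗-distribˡ p q s) (⊕-cong (⊗-comm p q) (⊗-comm p s)))

  isCommutativeRing : IsCommutativeRing _~_ _⊕_ _⊗_ ⊝_ (con 0#) (con 1#)
  isCommutativeRing = record
    { isRing = record
      { +-isAbelianGroup = record
        { isGroup = record
          { isMonoid = record
            { isSemigroup = record
              { isMagma = record { isEquivalence = ~-isEquivalence ; ∙-cong = ⊕-cong }
              ; assoc = ⊕-assoc }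
            ; identity = ⊕-idˡ , ⊕-identityʳ }
          ; inverse = ⊝-invˡ , λ p → ~trans (⊕-comm p (⊝ p)) (⊝-invˡ p)
          ; ⁻¹-cong = ⊝-cong }
        ; comm = ⊕-comm }
      ; *-cong = ⊗-cong
      ; *-assoc = ⊗-assoc
      ; *-identity = ⊗-idˡ , ⊗-identityʳ
      ; distrib = ⊗-distribˡ , ⊗-distribʳ }
    ; *-comm = ⊗-comm }
    where
    ~-isEquivalence : IsEquivalence _~_
    ~-isEquivalence = record { refl = ~refl ; sym = ~sym ; trans = ~trans }

  quotientRing : CommutativeRing c (c ⊔ ℓ)
  quotientRing = record { isCommutativeRing = isCommutativeRing }

  quotientRing-char2 : HasChar2 quotientRing
  quotientRing-char2 = ~trans (~sym (con-+ 1# 1#)) (con-cong char2)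

  module F₂ = Characteristic2 F char2
  module R₂ = Characteristic2 quotientRing quotientRing-char2
  open R₂ using (minor; permanent; symmetric-permanent-cong)
  open import Algebra.Properties.Semiring.Sum (CommutativeRing.semiring quotientRing) using (sum; sum-cong-≋)
  open import Relation.Binary.Reasoning.Setoid (CommutativeRing.setoid quotientRing)

  eval : Expr → Carrier
  eval (var i) = l i
  eval (con a) = a
  eval (p ⊕ q) = eval p + eval q
  eval (p ⊗ q) = eval p * eval q
  eval (⊝ p)   = - eval p

  eval-cong : ∀ {p q} → p ~ q → eval p ≈ eval q
  eval-cong ~refl                = refl
  eval-cong (~sym p~q)           = sym (eval-cong p~q)
  eval-cong (~trans p~q q~s)     = trans (eval-cong p~q) (eval-cong q~s)
  eval-cong (⊕-cong p~p′ q~q′)   = +-cong (eval-cong p~p′) (eval-cong q~q′)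
  eval-cong (⊗-cong p~p′ q~q′)   = *-cong (eval-cong p~p′) (eval-cong q~q′)
  eval-cong (⊝-cong p~q)         = -‿cong (eval-cong p~q)
  eval-cong (⊕-assoc p q s)      = +-assoc _ _ _
  eval-cong (⊕-comm p q)         = +-comm _ _
  eval-cong (⊕-idˡ p)            = +-identityˡ _
  eval-cong (⊝-invˡ p)           = -‿inverseˡ _
  eval-cong (⊗-assoc p q s)      = *-assoc _ _ _
  eval-cong (⊗-comm p q)         = *-comm _ _
  eval-cong (⊗-idˡ p)            = *-identityˡ _
  eval-cong (⊗-distribˡ p q s)   = distribˡ _ _ _
  eval-cong (con-cong a≈b)       = a≈b
  eval-cong (con-+ a b)          = refl
  eval-cong (con-* a b)          = refl
  eval-cong (rel i)              = F₂.x+x≈0 (l i * l i)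

  square≈eval-square : ∀ e → e ⊗ e ~ con (eval e * eval e)
  square≈eval-square (var i) = R₂.x+y≈0⇒x≈y (rel i)
  square≈eval-square (con a) = ~sym (con-* a a)
  square≈eval-square (p ⊕ q) = begin
    (p ⊕ q) ⊗ (p ⊕ q)                              ≈⟨ R₂.square-+ p q ⟩
    p ⊗ p ⊕ q ⊗ q                                  ≈⟨ ⊕-cong (square≈eval-square p) (square≈eval-square q) ⟩
    con (eval p * eval p) ⊕ con (eval q * eval q)  ≈⟨ con-+ _ _ ⟨
    con (eval p * eval p + eval q * eval q)        ≈⟨ con-cong (F₂.square-+ (eval p) (eval q)) ⟨
    con ((eval p + eval q) * (eval p + eval q))    ∎
  square≈eval-square (p ⊗ q) = begin
    (p ⊗ q) ⊗ (p ⊗ q)                              ≈⟨ interchange (CommutativeRing.*-commutativeSemigroup quotientRing) p q p q ⟩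
    (p ⊗ p) ⊗ (q ⊗ q)                              ≈⟨ ⊗-cong (square≈eval-square p) (square≈eval-square q) ⟩
    con (eval p * eval p) ⊗ con (eval q * eval q)  ≈⟨ con-* _ _ ⟨
    con ((eval p * eval p) * (eval q * eval q))    ≈⟨ con-cong (interchange *-commutativeSemigroup (eval p) (eval q) (eval p) (eval q)) ⟨
    con ((eval p * eval q) * (eval p * eval q))    ∎
  square≈eval-square (⊝ p) = begin
    (⊝ p) ⊗ (⊝ p)                                  ≈⟨ ⊗-cong (R₂.-x≈x p) (R₂.-x≈x p) ⟩
    p ⊗ p                                          ≈⟨ square≈eval-square p ⟩
    con (eval p * eval p)                          ≈⟨ con-cong (*-cong (F₂.-x≈x (eval p)) (F₂.-x≈x (eval p))) ⟨
    con (- eval p * - eval p)                      ∎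

  altSum≈sum : ∀ {k} (f : Fin k → Expr) → altSum f ~ sum f
  altSum≈sum {zero}  f = ~refl
  altSum≈sum {suc k} f = ⊕-cong ~refl (~trans (R₂.-x≈x _) (altSum≈sum (f ∘ suc)))

  det≈permanentanent : ∀ {n} (M : Matrix n) → det M ~ permanent M
  det≈permanentanent {zero}  M = ~refl
  det≈permanentanent {suc n} M = ~trans (altSum≈sum (λ j → M zero j ⊗ det (minor zero j M)))
                              (sum-cong-≋ λ j → ⊗-cong (~refl {M zero j}) (det≈permanentanent (minor zero j M)))

  constOffDiagonal : ∀ {n} → Matrix n → Matrix n
  constOffDiagonal A i j with i ≟ j
  ... | yes _ = A i j
  ... | no  _ = con (eval (A i j))

  module _ {n} (A : Matrix n) where
    private
      B = constOffDiagonal A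

    constOffDiagonal-diagonal : ∀ i → B i i ~ A i i
    constOffDiagonal-diagonal i with i ≟ i
    ... | yes _   = ~refl
    ... | no i≢i  = ⊥-elim (i≢i ≡.refl)

    constOffDiagonal-constant : ∀ i j → i ≢ j → IsConstant (B i j)
    constOffDiagonal-constant i j i≢j with i ≟ j
    ... | yes i≡j = ⊥-elim (i≢j i≡j)
    ... | no _    = eval (A i j) , ~refl

    module _ (A-sym : IsSymmetric A) where

      constOffDiagonal-symmetric : IsSymmetric B
      constOffDiagonal-symmetric i j with i ≟ j | j ≟ i
      ... | yes _   | yes _   = A-sym i j
      ... | no _    | no _    = con-cong (eval-cong (A-sym i j))
      ... | yes i≡j | no j≢i  = ⊥-elim (j≢i (≡.sym i≡j))
      ... | no i≢j  | yes j≡i = ⊥-elim (i≢j (≡.sym j≡i))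

      constOffDiagonal-products : ∀ i j → A i j ⊗ A j i ~ B i j ⊗ B j i
      constOffDiagonal-products i j with i ≟ j | j ≟ i
      ... | yes _   | yes _   = ~refl
      ... | no _    | no _    = begin
        A i j ⊗ A j i                           ≈⟨ ⊗-cong ~refl (A-sym j i) ⟩
        A i j ⊗ A i j                           ≈⟨ square≈eval-square (A i j) ⟩
        con (eval (A i j) * eval (A i j))       ≈⟨ con-* _ _ ⟩
        con (eval (A i j)) ⊗ con (eval (A i j)) ≈⟨ ⊗-cong ~refl (con-cong (eval-cong (A-sym i j))) ⟩
        con (eval (A i j)) ⊗ con (eval (A j i)) ∎
      ... | yes i≡j | no j≢i  = ⊥-elim (j≢i (≡.sym i≡j))
      ... | no i≢j  | yes j≡i = ⊥-elim (i≢j (≡.sym j≡i))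

      det-constOffDiagonal : det B ~ det A
      det-constOffDiagonal = begin
        det B  ≈⟨ det≈permanentanent B ⟩
        permanent B ≈⟨ symmetric-permanent-cong A-sym constOffDiagonal-symmetric
                    (λ i → ~sym (constOffDiagonal-diagonal i)) constOffDiagonal-products ⟨
        permanent A ≈⟨ det≈permanentanent A ⟨
        det A  ∎

lemma4p5 : ∀ {c ℓ} (F : CommutativeRing c ℓ) → IsField F → HasChar2 F →
    (m : ℕ) (l : Fin m → CommutativeRing.Carrier F) (n : ℕ)
    (r : Quot.Expr F m l) (A : Quot.Matrix F m l n) →
    Quot.IsGSDR F m l A r →
    Σ (Quot.Matrix F m l n) λ B →
    Quot.IsGSDR F m l B r ×
    (∀ i j → i ≢ j → Quot.IsConstant F m l (B i j))
lemma4p5 F _ char2 m l n r A (A-sym , A-linear , detA≈r) =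
  constOffDiagonal A ,
  (constOffDiagonal-symmetric A A-sym , B-linear , ~trans (det-constOffDiagonal A A-sym) detA≈r) ,
  constOffDiagonal-constant A
  where
  open QuotientRing F char2 m l
  open Quot F m l using (~trans; IsLinear)
  B-linear : ∀ i → IsLinear (constOffDiagonal A i i)
  B-linear i with A-linear i
  ... | c₀ , a , Aii~linear = c₀ , a , ~trans (constOffDiagonal-diagonal A i) Aii~linear
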